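{- For every $\sigma\in G_N$: (1) $\mathcal F\circ(\sigma\otimes\mathrm{id})=\Delta_\sigma\circ\mathcal F$ on $\mathbb{Q}(\mu_N)\langle\langle\widetilde X\rangle\rangle$, and (2) $\mathcal F\circ\widetilde\Delta_\sigma=(\sigma\otimes\mathrm{id})\circ\mathcal F$ on $\mathbb{Q}(\mu_N)\langle\langle\widetilde X\rangle\rangle$, where $\sigma\otimes\mathrm{id}$ denotes applying $\sigma$ to the coefficients only: $\sum_wc_ww\mapsto\sum_w\sigma(c_w)w$.
   Context: Let $N\ge3$, $\mu_N$ the $N$-th roots of unity in $\mathbb{C}$, $\zeta_N=\exp(2\pi i/N)$, $\iota:\{1,\dots,N\}\to\mathbb{Z}/N\mathbb{Z}$ the residue bijection, $G_N=\mathrm{Gal}(\mathbb{Q}(\mu_N)/\mathbb{Q})$. Alphabets $X=\{x_0\}\cup\{x_\zeta:\zeta\in\mu_N\}$, $\widetilde X=\{\tilde x\}\cup\{\tilde x_\alpha:\alpha\in\mathbb{Z}/N\mathbb{Z}\}$; series algebras have coefficients in $\mathbb{Q}(\mu_N)$ (sums over words $w$). $\mathcal F$ is the continuous $\mathbb{Q}(\mu_N)$-algebra isomorphism $\tilde x\mapsto x_0$, $\tilde x_\alpha\mapsto\sum_{m=1}^N\zeta_N^{ -m\iota^{ -1}(\alpha)}x_{\zeta_N^m}$. For $\sigma\in G_N$ with $\sigma(\zeta_N)=\zeta_N^k$, $\gcd(k,N)=1$: $\delta$ is the algebra automorphism of $\mathbb{Q}\langle\langle X\rangle\rangle$ with $x_0\mapsto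 x_0$, $x_\zeta\mapsto x_{\zeta^k}$; $\tilde\delta$ is the algebra automorphism of $\mathbb{Q}\langle\langle\widetilde X\rangle\rangle$ with $\tilde x\mapsto\tilde x$, $\tilde x_\alpha\mapsto\tilde x_{k\alpha}$; $\Delta_\sigma(\sum_wc_ww)=\sum_w\sigma(c_w)\delta(w)$ and $\widetilde\Delta_\sigma(\sum_wc_ww)=\sum_w\sigma(c_w)\tilde\delta(w)$. -}

module Defs where

open import Level using (_⊔_)
open import Algebra.Bundles using (CommutativeRing)
open import Algebra.Morphism.Structures using (module RingMorphisms)
open import Data.Nat as ℕ using (ℕ; zero; suc; _<_; NonZero)
open import Data.Nat.DivMod using (_%_)
open import Data.Fin using (Fin; toℕ)
open import Data.List using (List; []; _∷_; map; concatMap; allFin; length)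
open import Data.Product using (_×_; ∃)
open import Data.Rational using (ℚ)
import Data.Rational.Properties as ℚP
open import Relation.Nullary using (¬_; yes; no)
open import Relation.Binary.PropositionalEquality using (_≡_)

module Cyc {c ℓ} (K : CommutativeRing c ℓ) where
  open CommutativeRing K

  IsField : Set (c ⊔ ℓ)
  IsField = (¬ (1# ≈ 0#)) × (∀ x → ¬ (x ≈ 0#) → ∃ λ y → x * y ≈ 1#)

  _^_ : Carrier → ℕ → Carrier
  x ^ zero  = 1#
  x ^ suc n = x * (x ^ n)

  IsPrimitiveRoot : ℕ → Carrier → Set ℓ
  IsPrimitiveRoot N ζ = (ζ ^ N ≈ 1#) × (∀ j → 0 < j → j < N → ¬ (ζ ^ j ≈ 1#))

  IsℚEmbedding : (ℚ → Carrier) → Set ℓ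
  IsℚEmbedding ι =
    RingMorphisms.IsRingHomomorphism
      (CommutativeRing.rawRing ℚP.+-*-commutativeRing) rawRing ι

  evalPoly : (ℚ → Carrier) → Carrier → List ℚ → Carrier
  evalPoly ι ζ []       = 0#
  evalPoly ι ζ (q ∷ qs) = ι q + ζ * evalPoly ι ζ qs

  GeneratedBy : (ℚ → Carrier) → Carrier → Set (c ⊔ ℓ)
  GeneratedBy ι ζ = ∀ x → ∃ λ (qs : List ℚ) → x ≈ evalPoly ι ζ qs

  -- (K, ι, ζ) is a copy of ℚ(μ_N) with ζ corresponding to ζ_N
  IsCyclotomicField : ℕ → (ℚ → Carrier) → Carrier → Set (c ⊔ ℓ)
  IsCyclotomicField N ι ζ =
    IsField × IsℚEmbedding ι × IsPrimitiveRoot N ζ × GeneratedBy ι ζ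

  IsGaloisElement : (ℚ → Carrier) → (Carrier → Carrier) → Set (c ⊔ ℓ)
  IsGaloisElement ι σ =
    RingMorphisms.IsRingIsomorphism rawRing rawRing σ × (∀ q → σ (ι q) ≈ ι q)

  -- Alphabet X   : zero = x₀ ,  suc j = x_{ζ^{j}}  (j : Fin N, ζ^0 = ζ^N)
  -- Alphabet X̃  : zero = x̃  ,  suc a = x̃_a       (a : Fin N ≅ ℤ/Nℤ)

  Word : ℕ → Set
  Word N = List (Fin (suc N))

  Series : ℕ → Set c
  Series N = Word N → Carrier

  _≋_ : ∀ {N} → Series N → Series N → Set ℓ
  S ≋ T = ∀ u → S u ≈ T u

  words : (N n : ℕ) → List (Word N)
  words N zero    = [] ∷ []
  words N (suc n) = concatMap (λ a → map (a ∷_) (words N n)) (allFin (suc N))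

  sumOver : ∀ {A : Set} → List A → (A → Carrier) → Carrier
  sumOver []       f = 0#
  sumOver (x ∷ xs) f = f x + sumOver xs f

  -- coefficient of u in M(w_1)⋯M(w_n), where letter a ↦ Σ_b M a b · b
  prodMatch : ∀ {N} → (Fin (suc N) → Fin (suc N) → Carrier) → Word N → Word N → Carrier
  prodMatch M []      []      = 1#
  prodMatch M (a ∷ w) (b ∷ u) = M a b * prodMatch M w u
  prodMatch M []      (_ ∷ _) = 0#
  prodMatch M (_ ∷ _) []      = 0#

  -- the continuous algebra morphism determined by letter ↦ homogeneous linear
  -- combination of letters: (Σ_w c_w w) ↦ Σ_w c_w M(w)
  substitute : ∀ {N} → (Fin (suc N) → Fin (suc N) → Carrier) → Series N → Series N
  substitute {N} M S u = sumOver (words N (length u)) (λ w → S w * prodMatch M w u)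

  onCoeffs : ∀ {N} → (Carrier → Carrier) → Series N → Series N
  onCoeffs σ S w = σ (S w)

  -- representative in {1,…,N} of a residue / exponent (ι⁻¹, and m with ζ^m)
  rep : ∀ {N} → Fin N → ℕ
  rep {N} Fin.zero = N
  rep (Fin.suc j)  = toℕ (Fin.suc j)

  -- letter matrix of 𝓕 : x̃ ↦ x₀ , x̃_α ↦ Σ_{m=1}^N ζ^{-m ι⁻¹(α)} x_{ζ^m}
  -- (ζ^{-1} written as ζ^(N-1), valid since ζ^N = 1)
  𝓕mat : (N : ℕ) → Carrier → Fin (suc N) → Fin (suc N) → Carrier
  𝓕mat N ζ Fin.zero    Fin.zero    = 1#
  𝓕mat N ζ Fin.zero    (Fin.suc _) = 0#
  𝓕mat N ζ (Fin.suc _) Fin.zero    = 0#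
  𝓕mat N ζ (Fin.suc α) (Fin.suc m) = (ζ ^ (N ℕ.∸ 1)) ^ (rep m ℕ.* rep α)

  𝓕 : (N : ℕ) → Carrier → Series N → Series N
  𝓕 N ζ = substitute (𝓕mat N ζ)

  -- letter map x₀ ↦ x₀, x_ζ ↦ x_{ζ^k} (resp. x̃ ↦ x̃, x̃_α ↦ x̃_{kα}),
  -- on indices: suc j ↦ suc (j·k mod N); its matrix is the 0/1 indicator:
  -- permutation matrix of a letter substitution a ↦ a'
  δmat : (N k : ℕ) .{{_ : NonZero N}} → Fin (suc N) → Fin (suc N) → Carrier
  δmat N k Fin.zero    Fin.zero    = 1#
  δmat N k Fin.zero    (Fin.suc _) = 0#
  δmat N k (Fin.suc _) Fin.zero    = 0#
  δmat N k (Fin.suc j) (Fin.suc m) with toℕ m ℕ.≟ (toℕ j ℕ.* k) % N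
  ... | yes _ = 1#
  ... | no  _ = 0#

  Δ : (N k : ℕ) .{{_ : NonZero N}} → (Carrier → Carrier) → Series N → Series N
  Δ N k σ S = substitute (δmat N k) (onCoeffs σ S)

  -- Δ̃_σ on K⟨⟨X̃⟩⟩ :  Σ_w c_w w ↦ Σ_w σ(c_w) δ̃(w)   (same index pattern)
  Δ̃ : (N k : ℕ) .{{_ : NonZero N}} → (Carrier → Carrier) → Series N → Series N
  Δ̃ N k σ S = substitute (δmat N k) (onCoeffs σ S)

{-# OPTIONS --safe #-}
module Submission where

open import Defs
open import Level using (Level; 0ℓ)
open import Algebra.Bundles using (CommutativeRing)
open import Algebra.Morphism.Structures using (module RingMorphisms)
open import Data.Nat as ℕ using (ℕ; zero; suc; _≤_; NonZero; _∸_)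
open import Data.Nat.DivMod
  using (_%_; _/_; _mod_; m≡m%n+[m/n]*n; m%n%n≡m%n; %-distribˡ-*; [m+kn]%n≡m%n; m<n⇒m%n≡m; n%n≡0)
import Data.Nat.Properties as ℕP
open import Data.Nat.GCD using (gcd; gcd-GCD; GCD; module Bézout)
open import Data.Nat.Tactic.RingSolver using (solve-∀)
open import Data.Fin using (Fin; zero; suc; toℕ; lift; punchIn)
open import Data.Fin.Properties using (toℕ<n; toℕ-injective; toℕ-fromℕ<; punchInᵢ≢i)
open import Data.List using (List; []; _∷_; map; concatMap; allFin; length; _++_; tabulate)
open import Data.Product using (_×_; _,_; ∃-syntax)
open import Data.Rational using (ℚ)
open import Function using (_∘_; id)
open import Relation.Binary.Bundles using (Setoid)
open import Relation.Nullary using (yes; no)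
open import Relation.Nullary.Negation using (contradiction)
open import Relation.Binary.PropositionalEquality as ≡ using (_≡_; _≢_)

-- Each map in the statement is a letter substitution `substitute M`, possibly after σ ⊗ id.
-- Substitutions compose by the matrix product, substitute B ∘ substitute A = substitute (A ⊙ B),
-- and σ ⊗ id turns substitute M into substitute (σ ∘ M). Hence both identities reduce to identities
-- of (N+1)×(N+1) letter matrices: δ ⊙ 𝓕 = σ𝓕 and σ𝓕 ⊙ δ = 𝓕. Since σ ζ = ζᵏ, σ multiplies the
-- exponent of each entry ζ^(-mα) of 𝓕 by k, so σ𝓕 is 𝓕 with its rows permuted by α ↦ kα, and δ is
-- the matrix of exactly this permutation. As 𝓕 is symmetric, σ𝓕 is also 𝓕 with its columns
-- permuted by m ↦ km, which right multiplication by δ undoes because k is a unit modulo N.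

module Congruence (N : ℕ) .{{_ : NonZero N}} where
  open import Data.Nat using (_+_; _*_)

  -- A record rather than the bare equation a % N ≡ b % N, so that a and b can be inferred.
  infix 4 _≡ₘ_
  record _≡ₘ_ (a b : ℕ) : Set where
    constructor mod-≡
    field %-≡ : a % N ≡ b % N
  open _≡ₘ_

  ≡ₘ-setoid : Setoid 0ℓ 0ℓ
  ≡ₘ-setoid = record
    { Carrier       = ℕ
    ; _≈_           = _≡ₘ_
    ; isEquivalence = record
      { refl  = mod-≡ ≡.refl
      ; sym   = λ a≡b → mod-≡ (≡.sym (%-≡ a≡b))
      ; trans = λ a≡b b≡c → mod-≡ (≡.trans (%-≡ a≡b) (%-≡ b≡c))
      }
    }

  open Setoid ≡ₘ-setoid public
    using () renaming (refl to ≡ₘ-refl; trans to ≡ₘ-trans; reflexive to ≡⇒≡ₘ)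

  *-congₘ : ∀ {a b c d} → a ≡ₘ b → c ≡ₘ d → a * c ≡ₘ b * d
  *-congₘ {a} {b} {c} {d} (mod-≡ a≡b) (mod-≡ c≡d) = mod-≡ (begin
    (a * c) % N             ≡⟨ %-distribˡ-* a c N ⟩
    (a % N * (c % N)) % N   ≡⟨ ≡.cong₂ (λ x y → (x * y) % N) a≡b c≡d ⟩
    (b % N * (d % N)) % N   ≡⟨ %-distribˡ-* b d N ⟨
    (b * d) % N             ∎)
    where open ≡.≡-Reasoning

  +-multipleₘ : ∀ a q → a + q * N ≡ₘ a
  +-multipleₘ a q = mod-≡ ([m+kn]%n≡m%n a q N)

  toℕ-mod : ∀ a → toℕ (a mod N) ≡ₘ a
  toℕ-mod a = mod-≡ (≡.trans (≡.cong (_% N) (toℕ-fromℕ< _)) (m%n%n≡m%n a N))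

  toℕ-injectiveₘ : ∀ {i j : Fin N} → toℕ i ≡ₘ toℕ j → i ≡ j
  toℕ-injectiveₘ {i} {j} (mod-≡ e) = toℕ-injective (begin
    toℕ i       ≡⟨ m<n⇒m%n≡m (toℕ<n i) ⟨
    toℕ i % N   ≡⟨ e ⟩
    toℕ j % N   ≡⟨ m<n⇒m%n≡m (toℕ<n j) ⟩
    toℕ j       ∎)
    where open ≡.≡-Reasoning

  modular-inverse : ∀ k → gcd k N ≡ 1 → ∃[ v ] v * k ≡ₘ 1
  modular-inverse k gcd≡1 with Bézout.identity (≡.subst (GCD k N) gcd≡1 (gcd-GCD k N))
  ... | Bézout.+- x y 1+yN≡xk = x , ≡ₘ-trans (≡⇒≡ₘ (≡.sym 1+yN≡xk)) (+-multipleₘ 1 y)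
  -- Here x k ≡ -1, so (N - 1) x inverts k.
  ... | Bézout.-+ x y 1+xk≡yN = ℕ.pred N * x , (begin
    ℕ.pred N * x * k                        ≈⟨ +-multipleₘ _ y ⟨
    ℕ.pred N * x * k + y * N                ≡⟨ ≡.cong (ℕ.pred N * x * k +_) (≡.sym 1+xk≡yN) ⟩
    ℕ.pred N * x * k + (1 + x * k)          ≡⟨ arith (ℕ.pred N) x k ⟩
    1 + x * k * suc (ℕ.pred N)              ≡⟨ ≡.cong (λ m → 1 + x * k * m) (ℕP.suc-pred N) ⟩
    1 + x * k * N                           ≈⟨ +-multipleₘ 1 (x * k) ⟩
    1                                       ∎)
    where
    open import Relation.Binary.Reasoning.Setoid ≡ₘ-setoid
    arith : ∀ p x k → p * x * k + (1 + x * k) ≡ 1 + x * k * suc p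
    arith = solve-∀

  scale : ℕ → Fin N → Fin N
  scale k j = (toℕ j * k) mod N

  scale-inverseˡ : ∀ {v k} → v * k ≡ₘ 1 → ∀ j → scale k (scale v j) ≡ j
  scale-inverseˡ {v} {k} v*k≡1 j = toℕ-injectiveₘ (begin
    toℕ (scale k (scale v j))   ≈⟨ toℕ-mod _ ⟩
    toℕ (scale v j) * k         ≈⟨ *-congₘ (toℕ-mod _) (≡ₘ-refl {k}) ⟩
    toℕ j * v * k               ≡⟨ ℕP.*-assoc (toℕ j) v k ⟩
    toℕ j * (v * k)             ≈⟨ *-congₘ (≡ₘ-refl {toℕ j}) v*k≡1 ⟩
    toℕ j * 1                   ≡⟨ ℕP.*-identityʳ (toℕ j) ⟩
    toℕ j                       ∎)
    where open import Relation.Binary.Reasoning.Setoid ≡ₘ-setoid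

  scale-inverseʳ : ∀ {v k} → v * k ≡ₘ 1 → ∀ j → scale v (scale k j) ≡ j
  scale-inverseʳ {v} {k} v*k≡1 = scale-inverseˡ (≡ₘ-trans (≡⇒≡ₘ (ℕP.*-comm k v)) v*k≡1)

lift-inverse : ∀ {n} {f g : Fin n → Fin n} → (∀ j → f (g j) ≡ j) → ∀ a → lift 1 f (lift 1 g a) ≡ a
lift-inverse f∘g≗id zero    = ≡.refl
lift-inverse f∘g≗id (suc j) = ≡.cong suc (f∘g≗id j)

module Powers {c ℓ} (K : CommutativeRing c ℓ) where
  open CommutativeRing K hiding (zero)
  open Cyc K
  open import Relation.Binary.Reasoning.Setoid setoid
  import Algebra.Properties.Semiring.Exp semiring as Exp

  ^≡Exp^ : ∀ x n → x ^ n ≡ x Exp.^ n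
  ^≡Exp^ x zero    = ≡.refl
  ^≡Exp^ x (suc n) = ≡.cong (x *_) (^≡Exp^ x n)

  ^-congˡ : ∀ n {x y} → x ≈ y → x ^ n ≈ y ^ n
  ^-congˡ n {x} {y} rewrite ^≡Exp^ x n | ^≡Exp^ y n = Exp.^-congˡ n

  ^-homo-* : ∀ x m n → x ^ (m ℕ.+ n) ≈ x ^ m * x ^ n
  ^-homo-* x m n rewrite ^≡Exp^ x (m ℕ.+ n) | ^≡Exp^ x m | ^≡Exp^ x n = Exp.^-homo-* x m n

  ^-assocʳ : ∀ x m n → (x ^ m) ^ n ≈ x ^ (m ℕ.* n)
  ^-assocʳ x m n rewrite ^≡Exp^ (x ^ m) n | ^≡Exp^ x m | ^≡Exp^ x (m ℕ.* n) = Exp.^-assocʳ x m n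

  module _ {σ : Carrier → Carrier} (σ-hom : RingMorphisms.IsRingHomomorphism rawRing rawRing σ) where
    open RingMorphisms.IsRingHomomorphism σ-hom

    σ-^ : ∀ x n → σ (x ^ n) ≈ σ x ^ n
    σ-^ x zero    = 1#-homo
    σ-^ x (suc n) = trans (*-homo _ _) (*-congˡ (σ-^ x n))

    σ-^-rescale : ∀ {x k} → σ x ≈ x ^ k → ∀ n → σ (x ^ n) ≈ x ^ (k ℕ.* n)
    σ-^-rescale {x} {k} σx≈xᵏ n = begin
      σ (x ^ n)       ≈⟨ σ-^ x n ⟩
      σ x ^ n         ≈⟨ ^-congˡ n σx≈xᵏ ⟩
      (x ^ k) ^ n     ≈⟨ ^-assocʳ x k n ⟩
      x ^ (k ℕ.* n)   ∎

  module RootOfUnity (N : ℕ) .{{_ : NonZero N}} where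
    open Congruence N

    module _ {x : Carrier} (xᴺ≈1 : x ^ N ≈ 1#) where

      ^-multiple : ∀ q → x ^ (q ℕ.* N) ≈ 1#
      ^-multiple zero    = refl
      ^-multiple (suc q) = begin
        x ^ (N ℕ.+ q ℕ.* N)     ≈⟨ ^-homo-* x N (q ℕ.* N) ⟩
        x ^ N * x ^ (q ℕ.* N)   ≈⟨ *-cong xᴺ≈1 (^-multiple q) ⟩
        1# * 1#                 ≈⟨ *-identityˡ 1# ⟩
        1#                      ∎

      ^-% : ∀ a → x ^ a ≈ x ^ (a % N)
      ^-% a = begin
        x ^ a                             ≡⟨ ≡.cong (x ^_) (m≡m%n+[m/n]*n a N) ⟩
        x ^ (a % N ℕ.+ a / N ℕ.* N)       ≈⟨ ^-homo-* x (a % N) (a / N ℕ.* N) ⟩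
        x ^ (a % N) * x ^ (a / N ℕ.* N)   ≈⟨ *-congˡ (^-multiple (a / N)) ⟩
        x ^ (a % N) * 1#                  ≈⟨ *-identityʳ _ ⟩
        x ^ (a % N)                       ∎

      ^-≡ₘ : ∀ {a b} → a ≡ₘ b → x ^ a ≈ x ^ b
      ^-≡ₘ {a} {b} (mod-≡ a%N≡b%N) = trans (^-% a) (trans (reflexive (≡.cong (x ^_) a%N≡b%N)) (sym (^-% b)))

module Sums {c ℓ} (K : CommutativeRing c ℓ) where
  open CommutativeRing K hiding (zero)
  open Cyc K
  open import Relation.Binary.Reasoning.Setoid setoid
  open import Algebra.Properties.CommutativeMonoid.Sum +-commutativeMonoid
    using (sum; sum-remove; sum-cong-≋; sum-replicate-zero)
  open import Algebra.Properties.CommutativeSemigroup +-commutativeSemigroup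
    using () renaming (interchange to +-interchange)

  private variable A B : Set

  sumOver-cong : ∀ (xs : List A) {f g : A → Carrier} → (∀ x → f x ≈ g x) → sumOver xs f ≈ sumOver xs g
  sumOver-cong []       f≈g = refl
  sumOver-cong (x ∷ xs) f≈g = +-cong (f≈g x) (sumOver-cong xs f≈g)

  sumOver-zero : ∀ (xs : List A) {f : A → Carrier} → (∀ x → f x ≈ 0#) → sumOver xs f ≈ 0#
  sumOver-zero []       f≈0 = refl
  sumOver-zero (x ∷ xs) f≈0 = trans (+-cong (f≈0 x) (sumOver-zero xs f≈0)) (+-identityˡ 0#)

  sumOver-+ : ∀ (xs : List A) (f g : A → Carrier) →
              sumOver xs (λ x → f x + g x) ≈ sumOver xs f + sumOver xs g
  sumOver-+ []       f g = sym (+-identityˡ 0#)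
  sumOver-+ (x ∷ xs) f g = trans (+-congˡ (sumOver-+ xs f g)) (+-interchange _ _ _ _)

  *-distribˡ-sumOver : ∀ a (xs : List A) (f : A → Carrier) → a * sumOver xs f ≈ sumOver xs (λ x → a * f x)
  *-distribˡ-sumOver a []       f = zeroʳ a
  *-distribˡ-sumOver a (x ∷ xs) f = trans (distribˡ a _ _) (+-congˡ (*-distribˡ-sumOver a xs f))

  *-distribʳ-sumOver : ∀ a (xs : List A) (f : A → Carrier) → sumOver xs f * a ≈ sumOver xs (λ x → f x * a)
  *-distribʳ-sumOver a []       f = zeroˡ a
  *-distribʳ-sumOver a (x ∷ xs) f = trans (distribʳ a _ _) (+-congˡ (*-distribʳ-sumOver a xs f))

  sumOver-swap : (xs : List A) (ys : List B) (f : A → B → Carrier) →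
                 sumOver xs (λ x → sumOver ys (f x)) ≈ sumOver ys (λ y → sumOver xs (λ x → f x y))
  sumOver-swap []       ys f = sym (sumOver-zero ys (λ _ → refl))
  sumOver-swap (x ∷ xs) ys f = trans (+-congˡ (sumOver-swap xs ys f)) (sym (sumOver-+ ys (f x) _))

  sumOver-++ : ∀ (xs ys : List A) (f : A → Carrier) → sumOver (xs ++ ys) f ≈ sumOver xs f + sumOver ys f
  sumOver-++ []       ys f = sym (+-identityˡ _)
  sumOver-++ (x ∷ xs) ys f = trans (+-congˡ (sumOver-++ xs ys f)) (sym (+-assoc _ _ _))

  sumOver-map : (g : B → A) (xs : List B) (f : A → Carrier) →
                sumOver (map g xs) f ≈ sumOver xs (f ∘ g)
  sumOver-map g []       f = refl
  sumOver-map g (x ∷ xs) f = +-congˡ (sumOver-map g xs f)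

  sumOver-concatMap : (g : B → List A) (xs : List B) (f : A → Carrier) →
                      sumOver (concatMap g xs) f ≈ sumOver xs (λ x → sumOver (g x) f)
  sumOver-concatMap g []       f = refl
  sumOver-concatMap g (x ∷ xs) f = trans (sumOver-++ (g x) _ f) (+-congˡ (sumOver-concatMap g xs f))

  sumOver-tabulate : ∀ n (g : Fin n → A) (f : A → Carrier) → sumOver (tabulate g) f ≡ sum (f ∘ g)
  sumOver-tabulate zero    g f = ≡.refl
  sumOver-tabulate (suc n) g f = ≡.cong (f (g zero) +_) (sumOver-tabulate n (g ∘ suc) f)

  sumOver-allFin-point : ∀ {n} (f : Fin n → Carrier) i → (∀ j → j ≢ i → f j ≈ 0#) →
                         sumOver (allFin n) f ≈ f i
  sumOver-allFin-point {suc n} f i f≈0 = begin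
    sumOver (allFin (suc n)) f   ≡⟨ sumOver-tabulate (suc n) id f ⟩
    sum f                        ≈⟨ sum-remove f ⟩
    f i + sum (f ∘ punchIn i)    ≈⟨ +-congˡ (sum-cong-≋ {n} (λ j → f≈0 _ (punchInᵢ≢i i j))) ⟩
    f i + sum {n} (λ _ → 0#)     ≈⟨ +-congˡ (sum-replicate-zero n) ⟩
    f i + 0#                     ≈⟨ +-identityʳ (f i) ⟩
    f i                          ∎

  module _ {σ : Carrier → Carrier} (σ-hom : RingMorphisms.IsRingHomomorphism rawRing rawRing σ) where
    open RingMorphisms.IsRingHomomorphism σ-hom

    σ-sumOver : ∀ (xs : List A) (f : A → Carrier) → σ (sumOver xs f) ≈ sumOver xs (σ ∘ f)
    σ-sumOver []       f = 0#-homo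
    σ-sumOver (x ∷ xs) f = trans (+-homo _ _) (+-congˡ (σ-sumOver xs f))

module Substitution {c ℓ} (K : CommutativeRing c ℓ) where
  open CommutativeRing K hiding (zero)
  open Cyc K
  open Sums K
  open import Relation.Binary.Reasoning.Setoid setoid
  open import Algebra.Properties.CommutativeSemigroup *-commutativeSemigroup
    using () renaming (interchange to *-interchange)

  sumOver-words-suc : ∀ {N} m (f : Word N → Carrier) →
    sumOver (words N (suc m)) f ≈ sumOver (allFin (suc N)) (λ b → sumOver (words N m) (λ v → f (b ∷ v)))
  sumOver-words-suc {N} m f = trans (sumOver-concatMap (λ b → map (b ∷_) (words N m)) (allFin (suc N)) f)
                                    (sumOver-cong (allFin (suc N)) (λ b → sumOver-map (b ∷_) (words N m) f))

  sumOver-words-cong : ∀ {N} m {f g : Word N → Carrier} → (∀ v → length v ≡ m → f v ≈ g v) →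
                       sumOver (words N m) f ≈ sumOver (words N m) g
  sumOver-words-cong zero    f≈g = +-congʳ (f≈g [] ≡.refl)
  sumOver-words-cong {N} (suc m) {f} {g} f≈g = begin
    sumOver (words N (suc m)) f                                            ≈⟨ sumOver-words-suc m f ⟩
    sumOver (allFin (suc N)) (λ b → sumOver (words N m) (λ v → f (b ∷ v)))
      ≈⟨ sumOver-cong (allFin (suc N)) (λ b →
           sumOver-words-cong m (λ v |v|≡m → f≈g (b ∷ v) (≡.cong suc |v|≡m))) ⟩
    sumOver (allFin (suc N)) (λ b → sumOver (words N m) (λ v → g (b ∷ v))) ≈⟨ sumOver-words-suc m g ⟨
    sumOver (words N (suc m)) g                                            ∎

  Matrix : ℕ → Set c
  Matrix n = Fin n → Fin n → Carrier

  infixl 7 _⊙_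
  _⊙_ : ∀ {n} → Matrix n → Matrix n → Matrix n
  (A ⊙ B) a c = sumOver (allFin _) (λ b → A a b * B b c)

  record IsMatrixOf {n} (P : Matrix n) (π : Fin n → Fin n) : Set ℓ where
    field
      on-graph  : ∀ a → P a (π a) ≈ 1#
      off-graph : ∀ a b → b ≢ π a → P a b ≈ 0#

  module _ {n} {P : Matrix n} {π : Fin n → Fin n} (P-of-π : IsMatrixOf P π) where
    open IsMatrixOf P-of-π

    matrixOf-⊙ : ∀ (B : Matrix n) a c → (P ⊙ B) a c ≈ B (π a) c
    matrixOf-⊙ B a c = begin
      (P ⊙ B) a c             ≈⟨ sumOver-allFin-point _ (π a) off-π ⟩
      P a (π a) * B (π a) c   ≈⟨ *-congʳ (on-graph a) ⟩
      1# * B (π a) c          ≈⟨ *-identityˡ _ ⟩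
      B (π a) c               ∎
      where
      off-π : ∀ b → b ≢ π a → P a b * B b c ≈ 0#
      off-π b b≢πa = trans (*-congʳ (off-graph a b b≢πa)) (zeroˡ _)

    ⊙-matrixOf : ∀ {ρ : Fin n → Fin n} → (∀ b → ρ (π b) ≡ b) → (∀ c → π (ρ c) ≡ c) →
                 ∀ (A : Matrix n) a c → (A ⊙ P) a c ≈ A a (ρ c)
    ⊙-matrixOf {ρ} ρ∘π≗id π∘ρ≗id A a c = begin
      (A ⊙ P) a c             ≈⟨ sumOver-allFin-point _ (ρ c) off-ρ ⟩
      A a (ρ c) * P (ρ c) c   ≈⟨ *-congˡ on-ρ ⟩
      A a (ρ c) * 1#          ≈⟨ *-identityʳ _ ⟩
      A a (ρ c)               ∎
      where
      on-ρ : P (ρ c) c ≈ 1#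
      on-ρ = ≡.subst (λ c′ → P (ρ c) c′ ≈ 1#) (π∘ρ≗id c) (on-graph (ρ c))

      c≢π : ∀ {b} → b ≢ ρ c → c ≢ π b
      c≢π {b} b≢ρc c≡πb = b≢ρc (≡.trans (≡.sym (ρ∘π≗id b)) (≡.cong ρ (≡.sym c≡πb)))

      off-ρ : ∀ b → b ≢ ρ c → A a b * P b c ≈ 0#
      off-ρ b b≢ρc = trans (*-congˡ (off-graph b c (c≢π b≢ρc))) (zeroʳ _)

  ≋-setoid : ℕ → Setoid c ℓ
  ≋-setoid N = record
    { Carrier       = Series N
    ; _≈_           = _≋_
    ; isEquivalence = record
      { refl  = λ _ → refl
      ; sym   = λ S≋T u → sym (S≋T u)
      ; trans = λ S≋T T≋U u → trans (S≋T u) (T≋U u)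
      }
    }

  module _ {N : ℕ} where

    prodMatch-cong : ∀ {A B : Matrix (suc N)} → (∀ a b → A a b ≈ B a b) →
                     ∀ (w u : Word N) → prodMatch A w u ≈ prodMatch B w u
    prodMatch-cong A≈B []      []      = refl
    prodMatch-cong A≈B (a ∷ w) (b ∷ u) = *-cong (A≈B a b) (prodMatch-cong A≈B w u)
    prodMatch-cong A≈B []      (_ ∷ _) = refl
    prodMatch-cong A≈B (_ ∷ _) []      = refl

    substitute-cong : ∀ {A B : Matrix (suc N)} {S T : Series N} → (∀ a b → A a b ≈ B a b) → S ≋ T →
                      substitute A S ≋ substitute B T
    substitute-cong A≈B S≋T u =
      sumOver-cong (words N (length u)) (λ w → *-cong (S≋T w) (prodMatch-cong A≈B w u))

    prodMatch-⊙ : ∀ (A B : Matrix (suc N)) (w u : Word N) →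
                  sumOver (words N (length u)) (λ v → prodMatch A w v * prodMatch B v u)
                  ≈ prodMatch (A ⊙ B) w u
    prodMatch-⊙ A B []      []      = trans (+-identityʳ _) (*-identityʳ 1#)
    prodMatch-⊙ A B (_ ∷ _) []      = trans (+-identityʳ _) (zeroˡ 1#)
    prodMatch-⊙ A B []      (c ∷ u) = trans (sumOver-words-suc (length u) _)
      (sumOver-zero (allFin (suc N)) (λ b → sumOver-zero (words N (length u)) (λ v → zeroˡ _)))
    prodMatch-⊙ A B (a ∷ w) (c ∷ u) = begin
      sumOver (words N (suc (length u))) (λ v → prodMatch A (a ∷ w) v * prodMatch B v (c ∷ u))
        ≈⟨ sumOver-words-suc (length u) _ ⟩
      sumOver (allFin (suc N)) (λ b → sumOver W (λ v → (A a b * prodMatch A w v) * (B b c * prodMatch B v u)))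
        ≈⟨ sumOver-cong (allFin (suc N)) (λ b → sumOver-cong W (λ v → *-interchange _ _ _ _)) ⟩
      sumOver (allFin (suc N)) (λ b → sumOver W (λ v → (A a b * B b c) * (prodMatch A w v * prodMatch B v u)))
        ≈⟨ sumOver-cong (allFin (suc N)) (λ b → *-distribˡ-sumOver _ W _) ⟨
      sumOver (allFin (suc N)) (λ b → (A a b * B b c) * sumOver W (λ v → prodMatch A w v * prodMatch B v u))
        ≈⟨ *-distribʳ-sumOver _ (allFin (suc N)) _ ⟨
      (A ⊙ B) a c * sumOver W (λ v → prodMatch A w v * prodMatch B v u)
        ≈⟨ *-congˡ (prodMatch-⊙ A B w u) ⟩
      (A ⊙ B) a c * prodMatch (A ⊙ B) w u
        ∎
      where W = words N (length u)

    substitute-⊙ : ∀ (A B : Matrix (suc N)) (S : Series N) →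
                   substitute B (substitute A S) ≋ substitute (A ⊙ B) S
    substitute-⊙ A B S u = begin
      sumOver W (λ v → substitute A S v * prodMatch B v u)
        ≈⟨ sumOver-words-cong (length u) (λ v |v|≡|u| → *-congʳ (reflexive
             (≡.cong (λ m → sumOver (words N m) (λ w → S w * prodMatch A w v)) |v|≡|u|))) ⟩
      sumOver W (λ v → sumOver W (λ w → S w * prodMatch A w v) * prodMatch B v u)
        ≈⟨ sumOver-cong W (λ v → *-distribʳ-sumOver _ W _) ⟩
      sumOver W (λ v → sumOver W (λ w → S w * prodMatch A w v * prodMatch B v u))
        ≈⟨ sumOver-swap W W _ ⟩
      sumOver W (λ w → sumOver W (λ v → S w * prodMatch A w v * prodMatch B v u))
        ≈⟨ sumOver-cong W (λ w →
             trans (sumOver-cong W (λ v → *-assoc _ _ _)) (sym (*-distribˡ-sumOver _ W _))) ⟩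
      sumOver W (λ w → S w * sumOver W (λ v → prodMatch A w v * prodMatch B v u))
        ≈⟨ sumOver-cong W (λ w → *-congˡ (prodMatch-⊙ A B w u)) ⟩
      sumOver W (λ w → S w * prodMatch (A ⊙ B) w u)
        ∎
      where W = words N (length u)

  module _ {σ : Carrier → Carrier} (σ-hom : RingMorphisms.IsRingHomomorphism rawRing rawRing σ) where
    open RingMorphisms.IsRingHomomorphism σ-hom

    σ-prodMatch : ∀ {N} (M : Matrix (suc N)) (w u : Word N) →
                  σ (prodMatch M w u) ≈ prodMatch (λ a b → σ (M a b)) w u
    σ-prodMatch M []      []      = 1#-homo
    σ-prodMatch M (a ∷ w) (b ∷ u) = trans (*-homo _ _) (*-congˡ (σ-prodMatch M w u))
    σ-prodMatch M []      (_ ∷ _) = 0#-homo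
    σ-prodMatch M (_ ∷ _) []      = 0#-homo

    onCoeffs-substitute : ∀ {N} (M : Matrix (suc N)) (S : Series N) →
      onCoeffs σ (substitute M S) ≋ substitute (λ a b → σ (M a b)) (onCoeffs σ S)
    onCoeffs-substitute {N} M S u = trans (σ-sumOver σ-hom (words N (length u)) _)
      (sumOver-cong (words N (length u)) (λ w → trans (*-homo _ _) (*-congˡ (σ-prodMatch M w u))))

module FourierGalois {c ℓ} (K : CommutativeRing c ℓ) (N : ℕ) .{{_ : NonZero N}} where
  open CommutativeRing K hiding (zero)
  open Cyc K
  open Powers K
  open RootOfUnity N
  open Substitution K
  open Congruence N

  rep≡ₘtoℕ : ∀ (j : Fin N) → rep j ≡ₘ toℕ j
  rep≡ₘtoℕ zero    = mod-≡ (n%n≡0 N)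
  rep≡ₘtoℕ (suc j) = ≡ₘ-refl

  rep-scale : ∀ k (m α : Fin N) → rep m ℕ.* rep (scale k α) ≡ₘ k ℕ.* (rep m ℕ.* rep α)
  rep-scale k m α = begin
    rep m ℕ.* rep (scale k α)   ≈⟨ *-congₘ (≡ₘ-refl {rep m}) (rep≡ₘtoℕ (scale k α)) ⟩
    rep m ℕ.* toℕ (scale k α)   ≈⟨ *-congₘ (≡ₘ-refl {rep m}) (toℕ-mod (toℕ α ℕ.* k)) ⟩
    rep m ℕ.* (toℕ α ℕ.* k)     ≈⟨ *-congₘ (≡ₘ-refl {rep m}) (*-congₘ (rep≡ₘtoℕ α) ≡ₘ-refl) ⟨
    rep m ℕ.* (rep α ℕ.* k)     ≡⟨ ℕP.*-assoc (rep m) (rep α) k ⟨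
    rep m ℕ.* rep α ℕ.* k       ≡⟨ ℕP.*-comm (rep m ℕ.* rep α) k ⟩
    k ℕ.* (rep m ℕ.* rep α)     ∎
    where open import Relation.Binary.Reasoning.Setoid ≡ₘ-setoid

  δmat-isMatrixOf : ∀ k → IsMatrixOf (δmat N k) (lift 1 (scale k))
  δmat-isMatrixOf k = record { on-graph = on-graph ; off-graph = off-graph }
    where
    on-graph : ∀ a → δmat N k a (lift 1 (scale k) a) ≈ 1#
    on-graph zero = refl
    on-graph (suc j) with toℕ (scale k j) ℕ.≟ (toℕ j ℕ.* k) % N
    ... | yes _   = refl
    ... | no  ≢jk = contradiction (toℕ-fromℕ< _) ≢jk

    off-graph : ∀ a b → b ≢ lift 1 (scale k) a → δmat N k a b ≈ 0#
    off-graph zero    zero    b≢πa = contradiction ≡.refl b≢πa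
    off-graph zero    (suc _) _    = refl
    off-graph (suc _) zero    _    = refl
    off-graph (suc j) (suc m) b≢πa with toℕ m ℕ.≟ (toℕ j ℕ.* k) % N
    ... | yes m≡jk =
      contradiction (≡.cong suc (toℕ-injective (≡.trans m≡jk (≡.sym (toℕ-fromℕ< _))))) b≢πa
    ... | no  _    = refl

  module _ {ζ : Carrier} (ζᴺ≈1 : ζ ^ N ≈ 1#) where
    open import Relation.Binary.Reasoning.Setoid setoid

    ω : Carrier
    ω = ζ ^ (N ∸ 1)

    ωᴺ≈1 : ω ^ N ≈ 1#
    ωᴺ≈1 = trans (^-assocʳ ζ (N ∸ 1) N) (^-multiple ζᴺ≈1 (N ∸ 1))

    𝓕mat-sym : ∀ a b → 𝓕mat N ζ a b ≈ 𝓕mat N ζ b a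
    𝓕mat-sym zero    zero    = refl
    𝓕mat-sym zero    (suc _) = refl
    𝓕mat-sym (suc _) zero    = refl
    𝓕mat-sym (suc α) (suc m) = reflexive (≡.cong (ω ^_) (ℕP.*-comm (rep m) (rep α)))

    module Galois {σ : Carrier → Carrier} (σ-hom : RingMorphisms.IsRingHomomorphism rawRing rawRing σ)
                  {k : ℕ} (σζ≈ζᵏ : σ ζ ≈ ζ ^ k) where
      open RingMorphisms.IsRingHomomorphism σ-hom using (⟦⟧-cong; 0#-homo; 1#-homo)

      σ𝓕mat : Matrix (suc N)
      σ𝓕mat a b = σ (𝓕mat N ζ a b)

      σω≈ωᵏ : σ ω ≈ ω ^ k
      σω≈ωᵏ = begin
        σ (ζ ^ (N ∸ 1))       ≈⟨ σ-^-rescale σ-hom {k = k} σζ≈ζᵏ (N ∸ 1) ⟩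
        ζ ^ (k ℕ.* (N ∸ 1))   ≡⟨ ≡.cong (ζ ^_) (ℕP.*-comm k (N ∸ 1)) ⟩
        ζ ^ ((N ∸ 1) ℕ.* k)   ≈⟨ ^-assocʳ ζ (N ∸ 1) k ⟨
        ω ^ k                 ∎

      σ𝓕mat≈𝓕mat∘scale : ∀ a c → σ𝓕mat a c ≈ 𝓕mat N ζ (lift 1 (scale k) a) c
      σ𝓕mat≈𝓕mat∘scale zero    zero    = 1#-homo
      σ𝓕mat≈𝓕mat∘scale zero    (suc _) = 0#-homo
      σ𝓕mat≈𝓕mat∘scale (suc _) zero    = 0#-homo
      σ𝓕mat≈𝓕mat∘scale (suc α) (suc m) =
        trans (σ-^-rescale σ-hom {k = k} σω≈ωᵏ (rep m ℕ.* rep α))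
              (sym (^-≡ₘ ωᴺ≈1 (rep-scale k m α)))

      δ⊙𝓕≈σ𝓕 : ∀ a c → (δmat N k ⊙ 𝓕mat N ζ) a c ≈ σ𝓕mat a c
      δ⊙𝓕≈σ𝓕 a c =
        trans (matrixOf-⊙ (δmat-isMatrixOf k) (𝓕mat N ζ) a c) (sym (σ𝓕mat≈𝓕mat∘scale a c))

      σ𝓕⊙δ≈𝓕 : gcd k N ≡ 1 → ∀ a c → (σ𝓕mat ⊙ δmat N k) a c ≈ 𝓕mat N ζ a c
      σ𝓕⊙δ≈𝓕 gcd≡1 a c with modular-inverse k gcd≡1
      ... | v , v*k≡1 = begin
        (σ𝓕mat ⊙ δmat N k) a c   ≈⟨ ⊙-matrixOf (δmat-isMatrixOf k) ρ∘π≗id π∘ρ≗id σ𝓕mat a c ⟩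
        σ (𝓕mat N ζ a (ρ c))     ≈⟨ ⟦⟧-cong (𝓕mat-sym a (ρ c)) ⟩
        σ (𝓕mat N ζ (ρ c) a)     ≈⟨ σ𝓕mat≈𝓕mat∘scale (ρ c) a ⟩
        𝓕mat N ζ (π (ρ c)) a     ≡⟨ ≡.cong (λ b → 𝓕mat N ζ b a) (π∘ρ≗id c) ⟩
        𝓕mat N ζ c a             ≈⟨ 𝓕mat-sym c a ⟩
        𝓕mat N ζ a c             ∎
        where
        π ρ : Fin (suc N) → Fin (suc N)
        π = lift 1 (scale k)
        ρ = lift 1 (scale v)

        ρ∘π≗id : ∀ b → ρ (π b) ≡ b
        ρ∘π≗id = lift-inverse (scale-inverseʳ v*k≡1)

        π∘ρ≗id : ∀ c → π (ρ c) ≡ c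
        π∘ρ≗id = lift-inverse (scale-inverseˡ v*k≡1)

lemma3p13 : (N : ℕ) .{{_ : NonZero N}} → 3 ≤ N →
    {c ℓ : Level} (K : CommutativeRing c ℓ) →
    (ι : ℚ → CommutativeRing.Carrier K) (ζ : CommutativeRing.Carrier K) →
    Cyc.IsCyclotomicField K N ι ζ →
    (σ : CommutativeRing.Carrier K → CommutativeRing.Carrier K) →
    Cyc.IsGaloisElement K ι σ →
    (k : ℕ) → gcd k N ≡ 1 → CommutativeRing._≈_ K (σ ζ) (Cyc._^_ K ζ k) →
    (S : Cyc.Series K N) →
    Cyc._≋_ K (Cyc.𝓕 K N ζ (Cyc.onCoeffs K σ S)) (Cyc.Δ K N k σ (Cyc.𝓕 K N ζ S))
    × Cyc._≋_ K (Cyc.𝓕 K N ζ (Cyc.Δ̃ K N k σ S)) (Cyc.onCoeffs K σ (Cyc.𝓕 K N ζ S))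
lemma3p13 N _ K _ ζ (_ , _ , (ζᴺ≈1 , _) , _) σ (σ-iso , _) k gcd≡1 σζ≈ζᵏ S =
  𝓕∘σ≋Δ∘𝓕 , 𝓕∘Δ̃≋σ∘𝓕
  where
  open CommutativeRing K using (rawRing; refl; sym)
  open Cyc K
  open Substitution K
  open FourierGalois K N
  open Setoid (≋-setoid N) using () renaming (refl to ≋-refl)
  open import Relation.Binary.Reasoning.Setoid (≋-setoid N)

  σ-hom : RingMorphisms.IsRingHomomorphism rawRing rawRing σ
  σ-hom = RingMorphisms.IsRingIsomorphism.isRingHomomorphism σ-iso

  open Galois ζᴺ≈1 σ-hom {k = k} σζ≈ζᵏ

  δ : Matrix (suc N)
  δ = δmat N k

  𝓕∘σ≋Δ∘𝓕 : 𝓕 N ζ (onCoeffs σ S) ≋ Δ N k σ (𝓕 N ζ S)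
  𝓕∘σ≋Δ∘𝓕 = begin
    𝓕 N ζ (onCoeffs σ S)
      ≈⟨ substitute-cong (λ a c → sym (σ𝓕⊙δ≈𝓕 gcd≡1 a c)) ≋-refl ⟩
    substitute (σ𝓕mat ⊙ δ) (onCoeffs σ S)
      ≈⟨ substitute-⊙ σ𝓕mat δ (onCoeffs σ S) ⟨
    substitute δ (substitute σ𝓕mat (onCoeffs σ S))
      ≈⟨ substitute-cong (λ _ _ → refl) (onCoeffs-substitute σ-hom (𝓕mat N ζ) S) ⟨
    Δ N k σ (𝓕 N ζ S)
      ∎

  𝓕∘Δ̃≋σ∘𝓕 : 𝓕 N ζ (Δ̃ N k σ S) ≋ onCoeffs σ (𝓕 N ζ S)
  𝓕∘Δ̃≋σ∘𝓕 = begin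
    𝓕 N ζ (Δ̃ N k σ S)                          ≈⟨ substitute-⊙ δ (𝓕mat N ζ) (onCoeffs σ S) ⟩
    substitute (δ ⊙ 𝓕mat N ζ) (onCoeffs σ S)   ≈⟨ substitute-cong δ⊙𝓕≈σ𝓕 ≋-refl ⟩
    substitute σ𝓕mat (onCoeffs σ S)            ≈⟨ onCoeffs-substitute σ-hom (𝓕mat N ζ) S ⟨
    onCoeffs σ (𝓕 N ζ S)                       ∎
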